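{- Let $H$ be a hypergraph. If $H$ contains no singleton hyperedge, then $b_L^o(H)=b_L(H)$. Further, $b_L^o(\mathrm{core}(H))=b_L(H)$.
   Context: A hypergraph $H$ consists of a finite vertex set $V(H)$ and a finite collection $E(H)$ of nonempty subsets of $V(H)$. Lazy burning: a set $B\subseteq V(H)$ is burned initially; in each subsequent round every unburned vertex $v$ for which some hyperedge $h\ni v$ has $h\setminus\{v\}$ entirely burned becomes burned (so vertices of singleton hyperedges burn immediately); $b_L(H)$ is the minimum size of an initial set that eventually burns all vertices. Lazy burning without spontaneous burning is the same process except that $v$ burns only if there is a hyperedge $h\ni v$ with $|h|\ge2$ and $h\setminus\{v\}$ entirely burned; $b_L^o(H)$ is the corresponding minimum. For $U\subseteq V(H)$, $H[U]$ has vertex set $U$ and hyperedges $\{h\cap U: h\in E(H),\ h\cap U\neq\emptyset\}$. The core $\mathrm{core}(H)$ is $H[U]$ for the largest $U\subseteq V(H)$ such that every hyperedge of $H[U]$ has cardinality at least $2$. -}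

module Defs where

open import Data.Nat using (ℕ; _≤_)
open import Data.Fin using (Fin)
open import Data.Fin.Subset using (Subset; _∈_; _⊆_; _∩_; ∣_∣; Nonempty)
open import Data.Fin.Subset.Properties using (nonempty?)
open import Data.List using (List; map; filter)
open import Data.List.Relation.Unary.All using (All)
open import Data.List.Relation.Unary.Any using (Any)
open import Data.Product using (Σ; ∃; _×_; _,_)
open import Relation.Binary.PropositionalEquality using (_≡_)
open import Relation.Nullary using (¬_)

record Hypergraph (n : ℕ) : Set where
  constructor hypergraph
  field
    V : Subset n
    E : List (Subset n)
open Hypergraph public

IsHypergraph : ∀ {n} → Hypergraph n → Set
IsHypergraph H = All (λ h → h ⊆ V H × Nonempty h) (E H)

_∈E_ : ∀ {n} → Subset n → Hypergraph n → Set
h ∈E H = Any (h ≡_) (E H)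

-- Vertices eventually burned by lazy burning from initial set B
-- (least set containing B and closed under the burning rule).
data LBurned {n} (H : Hypergraph n) (B : Subset n) : Fin n → Set where
  init : ∀ {v} → v ∈ B → LBurned H B v
  step : ∀ {v} (h : Subset n) → h ∈E H → v ∈ h →
         (∀ u → u ∈ h → ¬ (u ≡ v) → LBurned H B u) → LBurned H B v

-- Same, without spontaneous burning: only hyperedges of size ≥ 2 fire.
data LoBurned {n} (H : Hypergraph n) (B : Subset n) : Fin n → Set where
  init : ∀ {v} → v ∈ B → LoBurned H B v
  step : ∀ {v} (h : Subset n) → h ∈E H → 2 ≤ ∣ h ∣ → v ∈ h →
         (∀ u → u ∈ h → ¬ (u ≡ v) → LoBurned H B u) → LoBurned H B v

IsBurningSet : ∀ {n} (H : Hypergraph n) →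
               (Subset n → Fin n → Set) → Subset n → Set
IsBurningSet H Burned B = B ⊆ V H × (∀ v → v ∈ V H → Burned B v)

IsMinBurning : ∀ {n} (H : Hypergraph n) →
               (Subset n → Fin n → Set) → ℕ → Set
IsMinBurning H Burned k =
  (Σ (Subset _) λ B → IsBurningSet H Burned B × ∣ B ∣ ≡ k)
  × (∀ B → IsBurningSet H Burned B → k ≤ ∣ B ∣)

IsLazyBurningNumber : ∀ {n} → Hypergraph n → ℕ → Set
IsLazyBurningNumber H = IsMinBurning H (LBurned H)

IsLazyBurningNumberO : ∀ {n} → Hypergraph n → ℕ → Set
IsLazyBurningNumberO H = IsMinBurning H (LoBurned H)

induced : ∀ {n} → Hypergraph n → Subset n → Hypergraph n
induced H U = hypergraph U (filter nonempty? (map (_∩ U) (E H)))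

CoreCandidate : ∀ {n} → Hypergraph n → Subset n → Set
CoreCandidate H U = All (λ h → 2 ≤ ∣ h ∣) (E (induced H U))

-- U is the largest subset of V(H) with every hyperedge of H[U] of size ≥ 2;
-- core(H) = induced H U.
IsCoreSet : ∀ {n} → Hypergraph n → Subset n → Set
IsCoreSet H U = U ⊆ V H × CoreCandidate H U
  × (∀ U' → U' ⊆ V H → CoreCandidate H U' → U' ⊆ U)

NoSingletonEdge : ∀ {n} → Hypergraph n → Set
NoSingletonEdge H = All (λ h → ¬ (∣ h ∣ ≡ 1)) (E H)

-- Without singleton hyperedges the two burning rules fire on exactly the same hyperedges, so
-- both processes burn the same vertices from any initial set.
--
-- For the core U: the vertices of V(H) that do not burn from the empty set form a set D all of
-- whose induced hyperedges have at least two vertices (a hyperedge meeting D in a single vertex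
-- would burn it), so D ⊆ U by maximality. Hence every vertex outside the core burns for free.
-- A burning set B of H therefore yields the burning set B ∩ U of core(H), where every hyperedge
-- has size at least 2 and burning is never spontaneous; conversely a burning set of core(H)
-- burns all of H.
module Submission where

open import Defs
open import Data.Empty using (⊥-elim)
open import Data.Fin using (Fin; toℕ; fromℕ<)
open import Data.Fin.Properties using (toℕ<n; toℕ-fromℕ<)
  renaming (any? to anyFin?; all? to allFin?; _≟_ to _≟ᶠ_)
open import Data.Fin.Subset using (Subset; _∈_; _⊆_; _⊃_; _∩_; ∣_∣; Nonempty; ⊥)
open import Data.Fin.Subset.Induction using (⊃-wellFounded)
open import Data.Fin.Subset.Properties
  using (nonempty?; _∈?_; _⊆?_; _⊂?_; anySubset?; x∈p∩q⁺; x∈p∩q⁻; ⊆-refl; ⊥⊆; ∣p∩q∣≤∣p∣;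
         x∈p⇒∣p-x∣<∣p∣; x∈p∧x≢y⇒x∈p-y)
open import Data.List.Membership.Propositional using (find; lose)
open import Data.List.Membership.Propositional.Properties
  using (∈-map⁺; ∈-map⁻; ∈-filter⁺; ∈-filter⁻)
open import Data.List.Relation.Unary.All as All using (All)
open import Data.List.Relation.Unary.Any using (Any; any?)
open import Data.Nat using (ℕ; _≤_; _<_; _≤?_; z≤n)
open import Data.Nat.Induction using (<-rec)
open import Data.Nat.Properties using (≤-refl; ≤-antisym; ≤-<-trans; ≤∧≢⇒<; ≮⇒≥)
  renaming (_≟_ to _≟ⁿ_)
open import Data.Product using (Σ; ∃; _×_; _,_; proj₁; proj₂)
open import Data.Sum using (_⊎_; inj₁; inj₂)
open import Data.Vec using (tabulate)
open import Data.Vec.Properties using (lookup∘tabulate; []=⇒lookup; lookup⇒[]=)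
open import Function using (_∘_)
open import Induction.WellFounded using (Acc; acc)
open import Level using (Level)
open import Relation.Binary.PropositionalEquality using (_≡_; _≢_; refl; sym; trans; subst; ≢-sym)
open import Relation.Nullary using (¬_; yes; no)
open import Relation.Nullary.Decidable
  using (does; dec-true; decidable-stable; _×-dec_; _⊎-dec_; _→-dec_; ¬?)
import Relation.Nullary.Decidable as Dec
open import Relation.Unary using (Pred; Decidable)

private
  variable
    ℓ : Level
    n : ℕ
    H : Hypergraph n
    B B' U h : Subset n
    v : Fin n

subsetOf : {P : Pred (Fin n) ℓ} → Decidable P → Subset n
subsetOf P? = tabulate (does ∘ P?)

module _ {P : Pred (Fin n) ℓ} (P? : Decidable P) where

  ∈-subsetOf⁺ : P v → v ∈ subsetOf P?
  ∈-subsetOf⁺ {v} pv = lookup⇒[]= v _ (trans (lookup∘tabulate _ v) (dec-true (P? v) pv))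

  ∈-subsetOf⁻ : v ∈ subsetOf P? → P v
  ∈-subsetOf⁻ {v} v∈ with P? v | trans (sym (lookup∘tabulate (does ∘ P?) v)) ([]=⇒lookup v∈)
  ... | yes pv | _ = pv
  ... | no _   | ()

x∈p⇒0<∣p∣ : {p : Subset n} {x : Fin n} → x ∈ p → 0 < ∣ p ∣
x∈p⇒0<∣p∣ x∈p = ≤-<-trans z≤n (x∈p⇒∣p-x∣<∣p∣ x∈p)

x∈p∧y∈p∧x≢y⇒1<∣p∣ : {p : Subset n} {x y : Fin n} → x ∈ p → y ∈ p → x ≢ y → 1 < ∣ p ∣
x∈p∧y∈p∧x≢y⇒1<∣p∣ x∈p y∈p x≢y =
  ≤-<-trans (x∈p⇒0<∣p∣ (x∈p∧x≢y⇒x∈p-y y∈p (≢-sym x≢y))) (x∈p⇒∣p-x∣<∣p∣ x∈p)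

inflationary-fixpoint : (f : Subset n → Subset n) → (∀ S → S ⊆ f S) →
                        (P : Pred (Subset n) ℓ) → (∀ {S} → P S → P (f S)) →
                        ∀ {S} → P S → ∃ λ C → P C × f C ⊆ C
inflationary-fixpoint f inflate P preserve = go (⊃-wellFounded _)
  where
  go : ∀ {S} → Acc _⊃_ S → P S → ∃ λ C → P C × f C ⊆ C
  go {S} (acc rec) pS with S ⊂? f S
  ... | yes S⊂fS = go (rec S⊂fS) (preserve pS)
  ... | no S⊄fS  = S , pS , closed
    where
    closed : f S ⊆ S
    closed {v} v∈fS with v ∈? S
    ... | yes v∈S = v∈S
    ... | no v∉S  = ⊥-elim (S⊄fS (inflate S , v , v∈fS , v∉S))

least-witness : {Q : Pred ℕ ℓ} → Decidable Q →
                ∀ {m} → Q m → ∃ λ k → Q k × (∀ {j} → Q j → k ≤ j)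
least-witness {Q = Q} Q? {m} = <-rec (λ m → Q m → _) search m
  where
  search : ∀ m → (∀ {j} → j < m → Q j → ∃ λ k → Q k × (∀ {j} → Q j → k ≤ j)) →
           Q m → ∃ λ k → Q k × (∀ {j} → Q j → k ≤ j)
  search m below qm with anyFin? {n = m} (Q? ∘ toℕ)
  ... | yes (j , qj) = below (toℕ<n j) qj
  ... | no none      = m , qm , λ {j} qj →
    ≮⇒≥ λ j<m → none (fromℕ< j<m , subst Q (sym (toℕ-fromℕ< j<m)) qj)

LBurned-mono : B ⊆ B' → LBurned H B v → LBurned H B' v
LBurned-mono B⊆B' (init v∈B) = init (B⊆B' v∈B)
LBurned-mono B⊆B' (step h h∈E v∈h rest) =
  step h h∈E v∈h (λ u u∈h u≢v → LBurned-mono B⊆B' (rest u u∈h u≢v))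

LoBurned⇒LBurned : LoBurned H B v → LBurned H B v
LoBurned⇒LBurned (init v∈B) = init v∈B
LoBurned⇒LBurned (step h h∈E _ v∈h rest) =
  step h h∈E v∈h (λ u u∈h u≢v → LoBurned⇒LBurned (rest u u∈h u≢v))

LBurned⇒LoBurned : NoSingletonEdge H → LBurned H B v → LoBurned H B v
LBurned⇒LoBurned noSingleton (init v∈B) = init v∈B
LBurned⇒LoBurned noSingleton (step h h∈E v∈h rest) =
  step h h∈E (≤∧≢⇒< (x∈p⇒0<∣p∣ v∈h) (≢-sym (All.lookup noSingleton h∈E))) v∈h
       (λ u u∈h u≢v → LBurned⇒LoBurned noSingleton (rest u u∈h u≢v))

module _ (H : Hypergraph n) (B : Subset n) where

  Fires : Subset n → Pred (Fin n) _
  Fires S v = Any (λ h → v ∈ h × (∀ u → u ∈ h → u ≢ v → u ∈ S)) (E H)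

  fires? : (S : Subset n) → Decidable (Fires S)
  fires? S v = any? (λ h → (v ∈? h) ×-dec
                           allFin? (λ u → (u ∈? h) →-dec (¬? (u ≟ᶠ v) →-dec (u ∈? S))))
                    (E H)

  burnedAfterRound? : (S : Subset n) → Decidable (λ v → v ∈ S ⊎ Fires S v)
  burnedAfterRound? S v = (v ∈? S) ⊎-dec fires? S v

  burningRound : Subset n → Subset n
  burningRound S = subsetOf (burnedAfterRound? S)

  private
    Invariant : Pred (Subset n) _
    Invariant S = B ⊆ S × (∀ {v} → v ∈ S → LBurned H B v)

    round-inflationary : ∀ S → S ⊆ burningRound S
    round-inflationary S = ∈-subsetOf⁺ (burnedAfterRound? S) ∘ inj₁

    round-preserves : ∀ {S} → Invariant S → Invariant (burningRound S)
    round-preserves {S} (B⊆S , sound) = round-inflationary S ∘ B⊆S , sound′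
      where
      sound′ : ∀ {v} → v ∈ burningRound S → LBurned H B v
      sound′ v∈ with ∈-subsetOf⁻ (burnedAfterRound? S) v∈
      ... | inj₁ v∈S = sound v∈S
      ... | inj₂ fires with find fires
      ... | h , h∈E , v∈h , rest = step h h∈E v∈h (λ u u∈h u≢v → sound (rest u u∈h u≢v))

    closed-complete : ∀ {C} → B ⊆ C → burningRound C ⊆ C → ∀ {v} → LBurned H B v → v ∈ C
    closed-complete B⊆C closed (init v∈B) = B⊆C v∈B
    closed-complete B⊆C closed (step h h∈E v∈h rest) =
      closed (∈-subsetOf⁺ (burnedAfterRound? _)
               (inj₂ (lose h∈E (v∈h , λ u u∈h u≢v → closed-complete B⊆C closed (rest u u∈h u≢v)))))

  burned? : Decidable (LBurned H B)
  burned? v with inflationary-fixpoint burningRound round-inflationary Invariant round-preserves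
                   {B} (⊆-refl , init)
  ... | C , (B⊆C , sound) , closed = Dec.map′ sound (closed-complete B⊆C closed) (v ∈? C)

isBurningSet? : (H : Hypergraph n) → Decidable (IsBurningSet H (LBurned H))
isBurningSet? H B = (B ⊆? V H) ×-dec allFin? (λ v → (v ∈? V H) →-dec burned? H B v)

lazyBurningNumber-exists : (H : Hypergraph n) → ∃ (IsLazyBurningNumber H)
lazyBurningNumber-exists H
  with least-witness (λ k → anySubset? (λ B → isBurningSet? H B ×-dec (∣ B ∣ ≟ⁿ k)))
                     (V H , (⊆-refl , λ _ → init) , refl)
... | k , witness , minimal = k , witness , λ B burning → minimal (B , burning , refl)

IsMinBurning-transfer : ∀ {H H' : Hypergraph n} {P P' : Subset n → Fin n → Set} {k} →
  IsMinBurning H P k →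
  (∀ B → IsBurningSet H' P' B → IsBurningSet H P B) →
  (∀ B → IsBurningSet H P B → ∃ λ B' → IsBurningSet H' P' B' × ∣ B' ∣ ≤ ∣ B ∣) →
  IsMinBurning H' P' k
IsMinBurning-transfer ((B , burning , refl) , minimal) back forth with forth B burning
... | B' , burning' , ∣B'∣≤∣B∣ =
  (B' , burning' , ≤-antisym ∣B'∣≤∣B∣ (minimal B' (back B' burning'))) ,
  λ B'' burning'' → minimal B'' (back B'' burning'')

∈E-induced⁺ : h ∈E H → Nonempty (h ∩ U) → (h ∩ U) ∈E induced H U
∈E-induced⁺ {U = U} h∈E nonempty = ∈-filter⁺ nonempty? (∈-map⁺ (_∩ U) h∈E) nonempty

∈E-induced⁻ : ∀ {h'} → h' ∈E induced H U → ∃ λ h → h ∈E H × h' ≡ h ∩ U × Nonempty h'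
∈E-induced⁻ {U = U} h'∈E with ∈-filter⁻ nonempty? h'∈E
... | h'∈map , nonempty with ∈-map⁻ (_∩ U) h'∈map
... | h , h∈E , refl = h , h∈E , refl , nonempty

LBurned⇒LoBurned-induced : CoreCandidate H U → LBurned H B v → v ∈ U →
                           LoBurned (induced H U) (B ∩ U) v
LBurned⇒LoBurned-induced candidate (init v∈B) v∈U = init (x∈p∩q⁺ (v∈B , v∈U))
LBurned⇒LoBurned-induced {H = H} {U = U} {v = v} candidate (step h h∈E v∈h rest) v∈U =
  step (h ∩ U) h∩U∈E (All.lookup candidate h∩U∈E) v∈h∩U λ u u∈h∩U u≢v →
    LBurned⇒LoBurned-induced candidate (rest u (proj₁ (x∈p∩q⁻ h U u∈h∩U)) u≢v)
                                       (proj₂ (x∈p∩q⁻ h U u∈h∩U))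
  where
  v∈h∩U : v ∈ h ∩ U
  v∈h∩U = x∈p∩q⁺ (v∈h , v∈U)
  h∩U∈E : (h ∩ U) ∈E induced H U
  h∩U∈E = ∈E-induced⁺ {H = H} h∈E (v , v∈h∩U)

burningSet⇒coreBurningSet : IsCoreSet H U → IsBurningSet H (LBurned H) B →
                            IsBurningSet (induced H U) (LoBurned (induced H U)) (B ∩ U)
burningSet⇒coreBurningSet {U = U} {B = B} (U⊆V , candidate , _) (_ , burns) =
  proj₂ ∘ x∈p∩q⁻ B U ,
  λ v v∈U → LBurned⇒LoBurned-induced candidate (burns v (U⊆V v∈U)) v∈U

module _ {H : Hypergraph n} (wellFormed : IsHypergraph H) where

  private
    edge⊆V : h ∈E H → h ⊆ V H
    edge⊆V h∈E = proj₁ (All.lookup wellFormed h∈E)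

  unburnable? : Decidable (λ v → v ∈ V H × ¬ LBurned H ⊥ v)
  unburnable? v = (v ∈? V H) ×-dec ¬? (burned? H ⊥ v)

  unburnable : Subset n
  unburnable = subsetOf unburnable?

  -- An edge meeting the unburnable set only in v would burn v from the empty set.
  ∣h∩unburnable∣≥2 : h ∈E H → v ∈ h ∩ unburnable → 2 ≤ ∣ h ∩ unburnable ∣
  ∣h∩unburnable∣≥2 {h} {v} h∈E v∈h∩D with 2 ≤? ∣ h ∩ unburnable ∣
  ... | yes 2≤ = 2≤
  ... | no 2≰  = ⊥-elim (proj₂ (∈-subsetOf⁻ unburnable? v∈D) (step h h∈E v∈h othersBurn))
    where
    v∈h : v ∈ h
    v∈h = proj₁ (x∈p∩q⁻ h unburnable v∈h∩D)

    v∈D : v ∈ unburnable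
    v∈D = proj₂ (x∈p∩q⁻ h unburnable v∈h∩D)

    othersBurn : ∀ u → u ∈ h → u ≢ v → LBurned H ⊥ u
    othersBurn u u∈h u≢v = decidable-stable (burned? H ⊥ u) λ unburnt →
      2≰ (x∈p∧y∈p∧x≢y⇒1<∣p∣
            (x∈p∩q⁺ (u∈h , ∈-subsetOf⁺ unburnable? (edge⊆V h∈E u∈h , unburnt))) v∈h∩D u≢v)

  unburnable-coreCandidate : CoreCandidate H unburnable
  unburnable-coreCandidate = All.tabulate (candidate ∘ ∈E-induced⁻ {H = H})
    where
    candidate : ∀ {h'} → (∃ λ h → h ∈E H × h' ≡ h ∩ unburnable × Nonempty h') → 2 ≤ ∣ h' ∣
    candidate (h , h∈E , refl , _ , v∈h∩D) = ∣h∩unburnable∣≥2 h∈E v∈h∩D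

  burnsInCore⇒burns : IsCoreSet H U → v ∈ V H → (v ∈ U → LBurned H B v) → LBurned H B v
  burnsInCore⇒burns {U = U} {v = v} (_ , _ , maximal) v∈V burnsInCore
    with v ∈? U | burned? H ⊥ v
  ... | yes v∈U | _          = burnsInCore v∈U
  ... | no _    | yes burnt  = LBurned-mono ⊥⊆ burnt
  ... | no v∉U  | no unburnt = ⊥-elim (v∉U (maximal unburnable (proj₁ ∘ ∈-subsetOf⁻ unburnable?)
                                 unburnable-coreCandidate (∈-subsetOf⁺ unburnable? (v∈V , unburnt))))

  LoBurned-induced⇒LBurned : IsCoreSet H U → LoBurned (induced H U) B v → LBurned H B v
  LoBurned-induced⇒LBurned core (init v∈B) = init v∈B
  LoBurned-induced⇒LBurned {U = U} core (step h' h'∈E _ v∈h' rest)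
    with ∈E-induced⁻ {H = H} {U = U} h'∈E
  ... | h , h∈E , refl , _ = step h h∈E (proj₁ (x∈p∩q⁻ h U v∈h')) λ u u∈h u≢v →
    burnsInCore⇒burns core (edge⊆V h∈E u∈h) λ u∈U →
      LoBurned-induced⇒LBurned core (rest u (x∈p∩q⁺ (u∈h , u∈U)) u≢v)

  coreBurningSet⇒burningSet : IsCoreSet H U →
                              IsBurningSet (induced H U) (LoBurned (induced H U)) B →
                              IsBurningSet H (LBurned H) B
  coreBurningSet⇒burningSet core (B⊆U , burns) =
    proj₁ core ∘ B⊆U ,
    λ v v∈V → burnsInCore⇒burns core v∈V λ v∈U → LoBurned-induced⇒LBurned core (burns v v∈U)

lazyBurningNumberO-noSingleton : ∀ {k} → NoSingletonEdge H →
                                 IsLazyBurningNumber H k → IsLazyBurningNumberO H k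
lazyBurningNumberO-noSingleton {H = H} noSingletonEdge bL =
  IsMinBurning-transfer {H = H} {H' = H} bL
    (λ _ (B⊆V , burns) → B⊆V , λ v v∈V → LoBurned⇒LBurned (burns v v∈V))
    (λ B (B⊆V , burns) →
       B , (B⊆V , λ v v∈V → LBurned⇒LoBurned noSingletonEdge (burns v v∈V)) , ≤-refl)

lazyBurningNumberO-core : ∀ {k} → IsHypergraph H → IsCoreSet H U →
                          IsLazyBurningNumber H k → IsLazyBurningNumberO (induced H U) k
lazyBurningNumberO-core {H = H} {U = U} wellFormed isCore bL =
  IsMinBurning-transfer {H = H} {H' = induced H U} bL
    (λ _ → coreBurningSet⇒burningSet wellFormed isCore)
    (λ B burning → B ∩ U , burningSet⇒coreBurningSet isCore burning , ∣p∩q∣≤∣p∣ B U)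

theorem4p2 : ∀ {n} (H : Hypergraph n) → IsHypergraph H →
    (NoSingletonEdge H →
      Σ ℕ λ k → IsLazyBurningNumberO H k × IsLazyBurningNumber H k)
    × (∀ U → IsCoreSet H U →
      Σ ℕ λ k → IsLazyBurningNumberO (induced H U) k × IsLazyBurningNumber H k)
theorem4p2 H wellFormed with lazyBurningNumber-exists H
... | k , bL = (λ noSingletonEdge → k , lazyBurningNumberO-noSingleton noSingletonEdge bL , bL)
             , (λ U isCore → k , lazyBurningNumberO-core wellFormed isCore bL , bL)
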